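{- For every graph $G$ with $n$ vertices and $m$ edges, \[ 2\sum_{uv\in E(G)}d(u)d(v)\geq4m^{2}+\sum_{u\in V(G)}\bigl(d^{3}(u)-n\,d^{2}(u)\bigr). \]
   Context: All graphs are finite, simple and undirected; $d(u)$ denotes the degree of vertex $u$, and the sum over $uv\in E(G)$ is over edges, each counted once. -}

module Defs where

open import Data.Nat using (ℕ; zero; suc; _+_; _*_; _<_)
open import Data.Nat.Properties using (_<?_)
open import Data.Fin using (Fin; toℕ)
import Data.Fin as Fin
open import Data.Bool using (Bool; true; false; if_then_else_; T; not)
open import Relation.Binary.PropositionalEquality using (_≡_)
open import Relation.Nullary.Decidable using (does)

∑ : {n : ℕ} → (Fin n → ℕ) → ℕ
∑ {zero}  f = 0
∑ {suc n} f = f Fin.zero + ∑ {n} (λ i → f (Fin.suc i))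

record Graph (n : ℕ) : Set where
  field
    adj   : Fin n → Fin n → Bool
    sym   : ∀ u v → adj u v ≡ adj v u
    irrefl : ∀ u → adj u u ≡ false

open Graph public

[_] : Bool → ℕ
[ true ]  = 1
[ false ] = 0

deg : {n : ℕ} → Graph n → Fin n → ℕ
deg G u = ∑ (λ v → [ adj G u v ])

-- Sum over edges uv ∈ E(G), each edge counted once (as the pair u < v).
∑E : {n : ℕ} → Graph n → (Fin n → Fin n → ℕ) → ℕ
∑E G f = ∑ (λ u → ∑ (λ v →
  if does (toℕ u <? toℕ v) then (if adj G u v then f u v else 0) else 0))

edges : {n : ℕ} → Graph n → ℕ
edges G = ∑E G (λ _ _ → 1)

-- Summed over all ordered pairs (u, v), the inequality
--   2 x(u) x(v) + [uv ∈ E] (x(u)² + x(v)²) ≤ x(u)² + x(v)² + 2 [uv ∈ E] x(u) x(v)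
-- is an equality on edges and AM-GM off them, so for arbitrary weights x it gives
--   (Σ x)² + Σ d(u) x(u)² ≤ n Σ x² + 2 Σ_{uv ∈ E} x(u) x(v),
-- i.e. Σ (x(u) − x(v))² ≥ 0 over non-adjacent pairs.  The theorem is the case x = d,
-- where Σ d = 2m by the handshake lemma.
module Submission where

open import Defs hiding (sym)
open import Data.Nat using (ℕ; _^_)
import Data.Nat as ℕ
open import Data.Bool using (true; false; if_then_else_)
open import Data.Fin using (Fin; toℕ)
import Data.Fin as Fin
open import Data.Fin.Properties using (toℕ-injective)
open import Data.Product using (_,_)
open import Data.Sum using (inj₁; inj₂)
open import Relation.Nullary using (Dec; yes; no; does)
open import Relation.Nullary.Negation using (contradiction)
open import Relation.Binary.PropositionalEquality
  using (_≡_; refl; sym; trans; cong; cong₂; subst; subst₂; module ≡-Reasoning)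

-- A separate module, so that ℕ's arithmetic operators do not clash with ℤ's below.
module DegreeSums where

  open import Data.Nat using (zero; suc; _+_; _*_; _≤_; _<_; z≤n)
  open import Data.Nat.Properties
  open import Data.Nat.Tactic.RingSolver using (solve-∀)

  private
    variable
      n : ℕ

  ∑-cong : {f g : Fin n → ℕ} → (∀ i → f i ≡ g i) → ∑ f ≡ ∑ g
  ∑-cong {zero}  _   = refl
  ∑-cong {suc n} f≗g = cong₂ _+_ (f≗g Fin.zero) (∑-cong (λ i → f≗g (Fin.suc i)))

  ∑-mono-≤ : {f g : Fin n → ℕ} → (∀ i → f i ≤ g i) → ∑ f ≤ ∑ g
  ∑-mono-≤ {zero}  _   = z≤n
  ∑-mono-≤ {suc n} f≤g = +-mono-≤ (f≤g Fin.zero) (∑-mono-≤ (λ i → f≤g (Fin.suc i)))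

  ∑-distrib-+ : (f g : Fin n → ℕ) → ∑ (λ i → f i + g i) ≡ ∑ f + ∑ g
  ∑-distrib-+ {zero}  f g = refl
  ∑-distrib-+ {suc n} f g = trans
    (cong (f Fin.zero + g Fin.zero +_) (∑-distrib-+ (λ i → f (Fin.suc i)) (λ i → g (Fin.suc i))))
    (+-+-interchange (f Fin.zero) (g Fin.zero) _ _)
    where
    +-+-interchange : ∀ a b c d → (a + b) + (c + d) ≡ (a + c) + (b + d)
    +-+-interchange = solve-∀

  *-distribˡ-∑ : ∀ c (f : Fin n → ℕ) → c * ∑ f ≡ ∑ (λ i → c * f i)
  *-distribˡ-∑ {zero}  c f = *-zeroʳ c
  *-distribˡ-∑ {suc n} c f = trans (*-distribˡ-+ c _ _)
    (cong (c * f Fin.zero +_) (*-distribˡ-∑ c (λ i → f (Fin.suc i))))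

  ∑-const : ∀ c → ∑ {n} (λ _ → c) ≡ n * c
  ∑-const {zero}  c = refl
  ∑-const {suc n} c = cong (c +_) (∑-const {n} c)

  ∑-comm : ∀ {m n} (h : Fin m → Fin n → ℕ) → ∑ (λ i → ∑ (λ j → h i j)) ≡ ∑ (λ j → ∑ (λ i → h i j))
  ∑-comm {zero}  {n} h = sym (trans (∑-const {n} 0) (*-zeroʳ n))
  ∑-comm {suc m}     h = trans (cong (∑ (h Fin.zero) +_) (∑-comm (λ i → h (Fin.suc i))))
                               (sym (∑-distrib-+ (h Fin.zero) _))

  ∑∑ : (Fin n → Fin n → ℕ) → ℕ
  ∑∑ h = ∑ (λ u → ∑ (λ v → h u v))

  ∑∑-cong : {h k : Fin n → Fin n → ℕ} → (∀ u v → h u v ≡ k u v) → ∑∑ h ≡ ∑∑ k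
  ∑∑-cong h≗k = ∑-cong (λ u → ∑-cong (h≗k u))

  ∑∑-mono-≤ : {h k : Fin n → Fin n → ℕ} → (∀ u v → h u v ≤ k u v) → ∑∑ h ≤ ∑∑ k
  ∑∑-mono-≤ h≤k = ∑-mono-≤ (λ u → ∑-mono-≤ (h≤k u))

  ∑∑-distrib-+ : (h k : Fin n → Fin n → ℕ) → ∑∑ (λ u v → h u v + k u v) ≡ ∑∑ h + ∑∑ k
  ∑∑-distrib-+ h k = trans (∑-cong (λ u → ∑-distrib-+ (h u) (k u))) (∑-distrib-+ (λ u → ∑ (h u)) (λ u → ∑ (k u)))

  *-distribˡ-∑∑ : ∀ c (h : Fin n → Fin n → ℕ) → c * ∑∑ h ≡ ∑∑ (λ u v → c * h u v)
  *-distribˡ-∑∑ c h = trans (*-distribˡ-∑ c (λ u → ∑ (h u))) (∑-cong (λ u → *-distribˡ-∑ c (h u)))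

  ∑∑-product : (x y : Fin n → ℕ) → ∑∑ (λ u v → x u * y v) ≡ ∑ x * ∑ y
  ∑∑-product x y = begin
    ∑ (λ u → ∑ (λ v → x u * y v)) ≡⟨ ∑-cong (λ u → sym (*-distribˡ-∑ (x u) y)) ⟩
    ∑ (λ u → x u * ∑ y)           ≡⟨ ∑-cong (λ u → *-comm (x u) (∑ y)) ⟩
    ∑ (λ u → ∑ y * x u)           ≡⟨ sym (*-distribˡ-∑ (∑ y) x) ⟩
    ∑ y * ∑ x                     ≡⟨ *-comm (∑ y) (∑ x) ⟩
    ∑ x * ∑ y                     ∎
    where open ≡-Reasoning

  ∑∑-const-right : (g : Fin n → ℕ) → ∑∑ {n} (λ u _ → g u) ≡ n * ∑ g
  ∑∑-const-right {n} g = trans (∑-cong (λ u → trans (∑-const {n} (g u)) (*-comm n (g u))))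
    (trans (∑-cong (λ u → *-comm (g u) n)) (sym (*-distribˡ-∑ n g)))

  ∑∑-const-left : (g : Fin n → ℕ) → ∑∑ {n} (λ _ v → g v) ≡ n * ∑ g
  ∑∑-const-left {n} g = trans (∑-comm {n} {n} (λ _ v → g v)) (∑∑-const-right g)

  upper : (Fin n → Fin n → ℕ) → Fin n → Fin n → ℕ
  upper h u v = if does (toℕ u <? toℕ v) then h u v else 0

  upper+upperᵀ : (h : Fin n → Fin n → ℕ) → (∀ u → h u u ≡ 0) → (∀ u v → h u v ≡ h v u) →
                 ∀ u v → h u v ≡ upper h u v + upper h v u
  upper+upperᵀ h h-diag h-sym u v = by-cases (toℕ u <? toℕ v) (toℕ v <? toℕ u)
    where
    by-cases : (u<v? : Dec (toℕ u < toℕ v)) (v<u? : Dec (toℕ v < toℕ u)) →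
               h u v ≡ (if does u<v? then h u v else 0) + (if does v<u? then h v u else 0)
    by-cases (yes u<v) (yes v<u) = contradiction v<u (<-asym u<v)
    by-cases (yes _)   (no _)    = sym (+-identityʳ (h u v))
    by-cases (no _)    (yes _)   = h-sym u v
    by-cases (no u≮v)  (no v≮u)  =
      subst (λ w → h u w ≡ 0) (toℕ-injective (≤-antisym (≮⇒≥ v≮u) (≮⇒≥ u≮v))) (h-diag u)

  ∑∑-symmetric : (h : Fin n → Fin n → ℕ) → (∀ u → h u u ≡ 0) → (∀ u v → h u v ≡ h v u) →
                 ∑∑ h ≡ 2 * ∑∑ (upper h)
  ∑∑-symmetric h h-diag h-sym = begin
    ∑∑ h                                                ≡⟨ ∑∑-cong (upper+upperᵀ h h-diag h-sym) ⟩
    ∑∑ (λ u v → upper h u v + upper h v u)              ≡⟨ ∑∑-distrib-+ (upper h) _ ⟩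
    ∑∑ (upper h) + ∑∑ (λ u v → upper h v u)             ≡⟨ cong (∑∑ (upper h) +_) (sym (∑-comm (upper h))) ⟩
    ∑∑ (upper h) + ∑∑ (upper h)                         ≡⟨ cong (∑∑ (upper h) +_) (sym (+-identityʳ _)) ⟩
    2 * ∑∑ (upper h)                                    ∎
    where open ≡-Reasoning

  onEdges : Graph n → (Fin n → Fin n → ℕ) → Fin n → Fin n → ℕ
  onEdges G f u v = if adj G u v then f u v else 0

  -- ∑E G f is by definition ∑∑ (upper (onEdges G f)).
  ∑∑-onEdges : (G : Graph n) (f : Fin n → Fin n → ℕ) → (∀ u v → f u v ≡ f v u) →
               ∑∑ (onEdges G f) ≡ 2 * ∑E G f
  ∑∑-onEdges G f f-sym = ∑∑-symmetric (onEdges G f) on-diag on-sym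
    where
    on-diag : ∀ u → onEdges G f u u ≡ 0
    on-diag u rewrite irrefl G u = refl
    on-sym : ∀ u v → onEdges G f u v ≡ onEdges G f v u
    on-sym u v rewrite Graph.sym G u v | f-sym u v = refl

  if-then-0≡[]* : ∀ b c → (if b then c else 0) ≡ [ b ] * c
  if-then-0≡[]* true  c = sym (+-identityʳ c)
  if-then-0≡[]* false c = refl

  ∑∑-onEdges-left : (G : Graph n) (g : Fin n → ℕ) → ∑∑ (onEdges G (λ u _ → g u)) ≡ ∑ (λ u → deg G u * g u)
  ∑∑-onEdges-left G g = ∑-cong λ u → begin
    ∑ (λ v → if adj G u v then g u else 0) ≡⟨ ∑-cong (λ v → if-then-0≡[]* (adj G u v) (g u)) ⟩
    ∑ (λ v → [ adj G u v ] * g u)         ≡⟨ ∑-cong (λ v → *-comm [ adj G u v ] (g u)) ⟩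
    ∑ (λ v → g u * [ adj G u v ])         ≡⟨ sym (*-distribˡ-∑ (g u) (λ v → [ adj G u v ])) ⟩
    g u * deg G u                         ≡⟨ *-comm (g u) (deg G u) ⟩
    deg G u * g u                         ∎
    where open ≡-Reasoning

  ∑∑-onEdges-right : (G : Graph n) (g : Fin n → ℕ) → ∑∑ (onEdges G (λ _ v → g v)) ≡ ∑ (λ u → deg G u * g u)
  ∑∑-onEdges-right G g = trans (∑-comm (onEdges G (λ _ v → g v)))
    (trans (∑∑-cong (λ u v → cong (λ b → if b then g u else 0) (Graph.sym G v u))) (∑∑-onEdges-left G g))

  handshake : (G : Graph n) → ∑ (deg G) ≡ 2 * edges G
  handshake G = begin
    ∑ (deg G)                              ≡⟨ ∑-cong (λ u → sym (*-identityʳ (deg G u))) ⟩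
    ∑ (λ u → deg G u * 1)                  ≡⟨ sym (∑∑-onEdges-left G (λ _ → 1)) ⟩
    ∑∑ (onEdges G (λ _ _ → 1))             ≡⟨ ∑∑-onEdges G (λ _ _ → 1) (λ _ _ → refl) ⟩
    2 * edges G                            ∎
    where open ≡-Reasoning

  x≤y⇒2xy≤x²+y² : ∀ {x y} → x ≤ y → 2 * (x * y) ≤ x ^ 2 + y ^ 2
  x≤y⇒2xy≤x²+y² {x} x≤y with k , refl ← m≤n⇒∃[o]m+o≡n x≤y =
    subst (2 * (x * (x + k)) ≤_) (sym (expand x k)) (m≤m+n _ (k * k))
    where
    expand : ∀ x k → x * (x * 1) + (x + k) * ((x + k) * 1) ≡ 2 * (x * (x + k)) + k * k
    expand = solve-∀

  2xy≤x²+y² : ∀ x y → 2 * (x * y) ≤ x ^ 2 + y ^ 2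
  2xy≤x²+y² x y with ≤-total x y
  ... | inj₁ x≤y = x≤y⇒2xy≤x²+y² x≤y
  ... | inj₂ y≤x = subst₂ _≤_ (cong (2 *_) (*-comm y x)) (+-comm (y ^ 2) (x ^ 2)) (x≤y⇒2xy≤x²+y² y≤x)

  pair-bound : ∀ b x y →
    2 * (x * y) + ((if b then x ^ 2 else 0) + (if b then y ^ 2 else 0))
      ≤ (x ^ 2 + y ^ 2) + 2 * (if b then x * y else 0)
  pair-bound true  x y = ≤-reflexive (+-comm (2 * (x * y)) (x ^ 2 + y ^ 2))
  pair-bound false x y = subst₂ _≤_ (sym (+-identityʳ _)) (sym (+-identityʳ _)) (2xy≤x²+y² x y)

  weighted-degree-bound : (G : Graph n) (x : Fin n → ℕ) →
    ∑ x * ∑ x + ∑ (λ u → deg G u * x u ^ 2) ≤ 2 * ∑E G (λ u v → x u * x v) + n * ∑ (λ u → x u ^ 2)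
  weighted-degree-bound {n} G x = *-cancelˡ-≤ 2 (begin
    2 * (∑ x * ∑ x + D)                                         ≡⟨ lhs-shape (∑ x * ∑ x) D ⟩
    2 * (∑ x * ∑ x) + (D + D)                                   ≡⟨ sym lhs-sum ⟩
    ∑∑ (λ u v → 2 * (x u * x v) + (onEdges G sqˡ u v + onEdges G sqʳ u v))
                                                                ≤⟨ ∑∑-mono-≤ (λ u v → pair-bound (adj G u v) (x u) (x v)) ⟩
    ∑∑ (λ u v → (sq u + sq v) + 2 * onEdges G xx u v)          ≡⟨ rhs-sum ⟩
    (n * ∑ sq + n * ∑ sq) + 2 * (2 * ∑E G xx)                   ≡⟨ rhs-shape n (∑ sq) (∑E G xx) ⟩
    2 * (2 * ∑E G xx + n * ∑ sq)                                ∎)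
    where
    open ≤-Reasoning
    sq : Fin n → ℕ
    sq u = x u ^ 2
    sqˡ sqʳ xx : Fin n → Fin n → ℕ
    sqˡ u _ = sq u
    sqʳ _ v = sq v
    xx u v = x u * x v
    D : ℕ
    D = ∑ (λ u → deg G u * sq u)

    lhs-sum : ∑∑ (λ u v → 2 * xx u v + (onEdges G sqˡ u v + onEdges G sqʳ u v)) ≡ 2 * (∑ x * ∑ x) + (D + D)
    lhs-sum = trans (∑∑-distrib-+ (λ u v → 2 * xx u v) (λ u v → onEdges G sqˡ u v + onEdges G sqʳ u v))
      (cong₂ _+_ (trans (sym (*-distribˡ-∑∑ 2 xx)) (cong (2 *_) (∑∑-product x x)))
                 (trans (∑∑-distrib-+ (onEdges G sqˡ) (onEdges G sqʳ))
                        (cong₂ _+_ (∑∑-onEdges-left G sq) (∑∑-onEdges-right G sq))))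

    rhs-sum : ∑∑ (λ u v → (sq u + sq v) + 2 * onEdges G xx u v) ≡ (n * ∑ sq + n * ∑ sq) + 2 * (2 * ∑E G xx)
    rhs-sum = trans (∑∑-distrib-+ (λ u v → sq u + sq v) (λ u v → 2 * onEdges G xx u v))
      (cong₂ _+_ (trans (∑∑-distrib-+ sqˡ sqʳ) (cong₂ _+_ (∑∑-const-right sq) (∑∑-const-left sq)))
                 (trans (sym (*-distribˡ-∑∑ 2 (onEdges G xx)))
                        (cong (2 *_) (∑∑-onEdges G xx (λ u v → *-comm (x u) (x v))))))

    lhs-shape : ∀ p d → 2 * (p + d) ≡ 2 * p + (d + d)
    lhs-shape = solve-∀
    rhs-shape : ∀ n q e → (n * q + n * q) + 2 * (2 * e) ≡ 2 * (2 * e + n * q)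
    rhs-shape = solve-∀

  degree-bound : (G : Graph n) →
    4 * edges G * edges G + ∑ (λ u → deg G u ^ 3)
      ≤ 2 * ∑E G (λ u v → deg G u * deg G v) + n * ∑ (λ u → deg G u ^ 2)
  -- The weight term deg G u * deg G u ^ 2 is definitionally deg G u ^ 3.
  degree-bound {n} G =
    subst (λ s → s + ∑ (λ u → deg G u ^ 3) ≤ 2 * ∑E G (λ u v → deg G u * deg G v) + n * ∑ (λ u → deg G u ^ 2))
          square-sum (weighted-degree-bound G (deg G))
    where
    square : ∀ m → 2 * m * (2 * m) ≡ 4 * m * m
    square = solve-∀
    square-sum : ∑ (deg G) * ∑ (deg G) ≡ 4 * edges G * edges G
    square-sum rewrite handshake G = square (edges G)

open DegreeSums using (degree-bound)

open import Data.Integer using (_+_; _-_; _*_; _≤_; +_; -_; +≤+)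
open import Data.Integer.Properties using (pos-*; +-assoc; +-monoˡ-≤; +-inverseʳ; +-identityʳ; module ≤-Reasoning)

a+s≤c+b⇒+a+[+s-+b]≤+c : ∀ {a s b c} → a ℕ.+ s ℕ.≤ c ℕ.+ b → + a + (+ s - + b) ≤ + c
a+s≤c+b⇒+a+[+s-+b]≤+c {a} {s} {b} {c} a+s≤c+b = begin
  + a + (+ s - + b)   ≡⟨ sym (+-assoc (+ a) (+ s) (- + b)) ⟩
  + (a ℕ.+ s) - + b   ≤⟨ +-monoˡ-≤ (- + b) (+≤+ a+s≤c+b) ⟩
  + (c ℕ.+ b) - + b   ≡⟨ +-assoc (+ c) (+ b) (- + b) ⟩
  + c + (+ b - + b)   ≡⟨ cong (λ z → + c + z) (+-inverseʳ (+ b)) ⟩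
  + c + + 0           ≡⟨ +-identityʳ (+ c) ⟩
  + c                 ∎
  where open ≤-Reasoning

proposition2 : (n : ℕ) → (G : Graph n) →
    (+ 4) * (+ edges G) * (+ edges G)
    + ((+ (∑ (λ u → deg G u ^ 3))) - (+ n) * (+ (∑ (λ u → deg G u ^ 2))))
    ≤ (+ 2) * (+ (∑E G (λ u v → deg G u ℕ.* deg G v)))
proposition2 n G = begin
  + 4 * + m * + m + (+ S₃ - + n * + S₂)         ≡⟨ cong₂ (λ p q → p + (+ S₃ - q)) (sym 4m²-pos) (sym (pos-* n S₂)) ⟩
  + (4 ℕ.* m ℕ.* m) + (+ S₃ - + (n ℕ.* S₂))     ≤⟨ a+s≤c+b⇒+a+[+s-+b]≤+c (degree-bound G) ⟩
  + (2 ℕ.* E)                                   ≡⟨ pos-* 2 E ⟩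
  + 2 * + E                                     ∎
  where
  open ≤-Reasoning
  m S₂ S₃ E : ℕ
  m  = edges G
  S₂ = ∑ (λ u → deg G u ^ 2)
  S₃ = ∑ (λ u → deg G u ^ 3)
  E  = ∑E G (λ u v → deg G u ℕ.* deg G v)
  4m²-pos : + (4 ℕ.* m ℕ.* m) ≡ + 4 * + m * + m
  4m²-pos = trans (pos-* (4 ℕ.* m) m) (cong (_* + m) (pos-* 4 m))
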